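{- Given the initial set of coefficients $$[a_0^{(3)}; a_1^{(3)},a_2^{(3)},a_3^{(3)},a_4^{(3)}]=[1;z_2-1,1,z_3-1,z_2]$$ of the continued fraction expansion of $S_3$, of length $\ell_3=4$, define a sequence of sets of coefficients $(\{a_j^{(n)}\}_{j=0}^{\ell_{n}-1})$ with $\ell_n=3\cdot 2^{n-2}-1$ for $n=3,4,5,\ldots$ recursively according to $$a_j^{(n+1)}=a_j^{(n)} \quad \text{for}\quad j=0,\ldots, \ell_{n}-1,$$ $$a_{\ell_{n}}^{(n+1)}=z_{n+1}-1, \qquad a_{\ell_{n}+1}^{(n+1)}=1, \qquad a_{\ell_{n}+2}^{(n+1)}= a_{\ell_{n}-1}^{(n)}-1,$$ and $$a_j^{(n+1)}=a_{2\ell_{n}-j+1}^{(n)} \quad \text{for}\quad j=\ell_{n}+3,\ldots, 2\ell_{n}.$$ Then the $n$th partial sum $S_n$ of the series $S=\sum_{j=1}^\infty 1/x_j$ has the continued fraction expansion $$S_n=[a_0^{(n)}; a_1^{(n)},\ldots, a_{\ell_n -1}^{(n)}].$$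
   Context: Let $(z_n)_{n\geq 2}$ be a sequence of positive integers with $z_2\geq 2$ (the $z_j$ may also be treated as variables). Define $x_1=1$ and $x_n=\prod_{j=2}^n z_j^{2^{n-j}}$ for $n\geq 2$, so that $x_n^2\mid x_{n+1}$, and consider the Engel series $S=\sum_{j=1}^\infty \frac{1}{x_j} = 1+\sum_{j=2}^\infty \frac{1}{z_2^{2^{j-2}} z_3^{2^{j-3}}\cdots z_j}$. Its $n$th partial sum is $S_n=\sum_{j=1}^n \frac{1}{x_j}$. The notation $[a_0;a_1,\ldots,a_m]$ denotes the finite continued fraction $a_0+\cfrac{1}{a_1+\cfrac{1}{\ddots+\cfrac{1}{a_m}}}$. -}

module Defs where

open import Data.Nat as ℕ using (ℕ; zero; suc; _∸_; _^_; _<ᵇ_; _≡ᵇ_; _≤ᵇ_)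
open import Data.Bool using (if_then_else_)
open import Data.Integer using (+_)
open import Data.List using (List; []; _∷_; map; upTo; foldr)
open import Data.Rational using (ℚ; 0ℚ; 1/_; _+_; _/_; ≢-nonZero)
open import Data.Rational.Properties using (_≟_)
open import Relation.Nullary using (yes; no)

-- Total reciprocal on ℚ (convention 1/0 := 0; never used at 0 in the theorem)
inv : ℚ → ℚ
inv p with p ≟ 0ℚ
... | yes _ = 0ℚ
... | no p≢0 = 1/_ p {{≢-nonZero p≢0}}

ℕ→ℚ : ℕ → ℚ
ℕ→ℚ n = (+ n) / 1

prodℕ : List ℕ → ℕ
prodℕ = foldr ℕ._*_ 1

-- x_j = ∏_{i=2}^{j} z_i^{2^{j-i}}  (empty product for j = 1, so x_1 = 1)
x : (ℕ → ℕ) → ℕ → ℕ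
x z j = prodℕ (map (λ k → z (k ℕ.+ 2) ^ (2 ^ (j ∸ (k ℕ.+ 2)))) (upTo (j ∸ 1)))

S : (ℕ → ℕ) → ℕ → ℚ
S z n = foldr _+_ 0ℚ (map (λ k → inv (ℕ→ℚ (x z (suc k)))) (upTo n))

-- finite continued fraction [a_0; a_1, ..., a_m]; empty list gives 0 (unused)
cf : List ℕ → ℚ
cf []           = 0ℚ
cf (a ∷ [])     = ℕ→ℚ a
cf (a ∷ b ∷ as) = ℕ→ℚ a + inv (cf (b ∷ as))

len : ℕ → ℕ
len n = 3 ℕ.* 2 ^ (n ∸ 2) ∸ 1

-- coefficient a_j^{(n)} (meaningful for n ≥ 3 and j < ℓ_n; 0 elsewhere)
coef : (ℕ → ℕ) → ℕ → ℕ → ℕ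
coef z 0 j = 0
coef z 1 j = 0
coef z 2 j = 0
coef z 3 0 = 1
coef z 3 1 = z 2 ∸ 1
coef z 3 2 = 1
coef z 3 3 = z 3 ∸ 1
coef z 3 4 = z 2
coef z 3 (suc (suc (suc (suc (suc _))))) = 0
coef z (suc (suc (suc (suc m)))) j =
  let ℓ = len (suc (suc (suc m)))
  in if j <ᵇ ℓ then coef z (suc (suc (suc m))) j
     else if j ≡ᵇ ℓ then z (suc (suc (suc (suc m)))) ∸ 1
     else if j ≡ᵇ suc ℓ then 1
     else if j ≡ᵇ ℓ ℕ.+ 2 then coef z (suc (suc (suc m))) (ℓ ∸ 1) ∸ 1
     else if j ≤ᵇ 2 ℕ.* ℓ then coef z (suc (suc (suc m))) (2 ℕ.* ℓ ∸ j ℕ.+ 1)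
     else 0

coefs : (ℕ → ℕ) → ℕ → List ℕ
coefs z n = map (coef z n) (upTo (len n))

module Submission where

-- Write M T for the product of the matrices [[a, 1], [1, 0]] over a list T of
-- partial quotients; its first column (p, q) gives [a; T] = (a p + q) / p.
-- For T the partial quotients a₁ … a_{ℓₙ-1} one proves by induction on n that
-- p = xₙ, det M T = 1 and Sₙ = [1; T].  The recursion of the statement turns T
-- into T ++ [w, 1, c] ++ R, where reverse T = (c + 1) ∷ R and w = z_{n+1} - 1.
-- Reversing a list transposes its matrix, so the new matrix is
-- M T · [[w + 1, -1], [1, 0]] · (M T)ᵀ, with first column ((w + 1) p², (w + 1) p q + 1)
-- (this uses det M T = 1).  Hence the continued fraction grows by exactly
-- 1 / ((w + 1) p²) = 1 / x_{n+1}, the term by which Sₙ grows.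

open import Data.Nat using (ℕ; zero; suc; _+_; _*_; _∸_; _^_; _≤_; _<_; z≤n; s≤s; z<s; s<s;
  NonZero; >-nonZero; >-nonZero⁻¹; _<ᵇ_; _≡ᵇ_; _≤ᵇ_)
open import Data.Nat.Properties
open import Data.Nat.ListAction using (product)
open import Data.Nat.ListAction.Properties using (product-++)
open import Data.Nat.Tactic.RingSolver using (solve-∀)
open import Data.Integer as ℤ using (ℤ; +_; -_; _⊖_)
import Data.Integer.Properties as ℤ
open import Data.Rational using (ℚ; 0ℚ; 1ℚ; 1/_; _/_; toℚᵘ; fromℚᵘ; ≢-nonZero)
  renaming (_+_ to _+ℚ_; _*_ to _*ℚ_)
import Data.Rational.Properties as ℚ
open import Data.Rational.Unnormalised as ℚᵘ using (mkℚᵘ; *≡*)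
import Data.Rational.Unnormalised.Properties as ℚᵘ
open import Data.Bool as Bool using (true; false)
open import Data.List using (List; []; _∷_; _++_; _∷ʳ_; [_]; applyUpTo; reverse; map; upTo; foldr)
open import Data.List.Properties using (applyUpTo-∷ʳ; map-upTo; reverse-++; unfold-reverse)
open import Data.Product using (∃; ∃₂; _×_; _,_; proj₁; proj₂)
open import Data.Empty using (⊥)
open import Function using (_∘_)
open import Relation.Binary.PropositionalEquality hiding ([_])
open import Relation.Nullary using (¬_; yes; no; contradiction)
open import Defs

applyUpTo-cong : ∀ {f g : ℕ → ℕ} n → (∀ i → i < n → f i ≡ g i) → applyUpTo f n ≡ applyUpTo g n
applyUpTo-cong zero    eq = refl
applyUpTo-cong (suc n) eq = cong₂ _∷_ (eq 0 z<s) (applyUpTo-cong n (λ i i<n → eq (suc i) (s<s i<n)))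

applyUpTo-++ : ∀ (f : ℕ → ℕ) m n → applyUpTo f (m + n) ≡ applyUpTo f m ++ applyUpTo (λ i → f (m + i)) n
applyUpTo-++ f zero    n = refl
applyUpTo-++ f (suc m) n = cong (f 0 ∷_) (applyUpTo-++ (f ∘ suc) m n)

reverse-applyUpTo : ∀ (f : ℕ → ℕ) n → reverse (applyUpTo f n) ≡ applyUpTo (λ i → f (n ∸ suc i)) n
reverse-applyUpTo f zero    = refl
reverse-applyUpTo f (suc n) = begin
  reverse (applyUpTo f (suc n))         ≡⟨ cong reverse (applyUpTo-∷ʳ f n) ⟨
  reverse (applyUpTo f n ++ [ f n ])    ≡⟨ reverse-++ (applyUpTo f n) [ f n ] ⟩
  f n ∷ reverse (applyUpTo f n)         ≡⟨ cong (f n ∷_) (reverse-applyUpTo f n) ⟩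
  f n ∷ applyUpTo (λ i → f (n ∸ suc i)) n ∎
  where open ≡-Reasoning

/-cross : ∀ a b c d .{{_ : NonZero b}} .{{_ : NonZero d}} →
          a * d ≡ c * b → + a / b ≡ + c / d
/-cross a (suc b) c (suc d) eq = ℚ.fromℚᵘ-cong {mkℚᵘ (+ a) b} {mkℚᵘ (+ c) d} (*≡* (begin
  + a ℤ.* + suc d   ≡⟨ ℤ.pos-* a (suc d) ⟨
  + (a * suc d)     ≡⟨ cong +_ eq ⟩
  + (c * suc b)     ≡⟨ ℤ.pos-* c (suc b) ⟩
  + c ℤ.* + suc b   ∎))
  where open ≡-Reasoning

fromℚᵘ-homo-+ : ∀ u v → fromℚᵘ u +ℚ fromℚᵘ v ≡ fromℚᵘ (u ℚᵘ.+ v)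
fromℚᵘ-homo-+ u v = ℚ.toℚᵘ-injective (ℚᵘ.≃-trans (ℚ.toℚᵘ-homo-+ (fromℚᵘ u) (fromℚᵘ v))
  (ℚᵘ.≃-trans (ℚᵘ.+-cong (ℚ.toℚᵘ-fromℚᵘ u) (ℚ.toℚᵘ-fromℚᵘ v))
              (ℚᵘ.≃-sym (ℚ.toℚᵘ-fromℚᵘ (u ℚᵘ.+ v)))))

fromℚᵘ-homo-* : ∀ u v → fromℚᵘ u *ℚ fromℚᵘ v ≡ fromℚᵘ (u ℚᵘ.* v)
fromℚᵘ-homo-* u v = ℚ.toℚᵘ-injective (ℚᵘ.≃-trans (ℚ.toℚᵘ-homo-* (fromℚᵘ u) (fromℚᵘ v))
  (ℚᵘ.≃-trans (ℚᵘ.*-cong (ℚ.toℚᵘ-fromℚᵘ u) (ℚ.toℚᵘ-fromℚᵘ v))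
              (ℚᵘ.≃-sym (ℚ.toℚᵘ-fromℚᵘ (u ℚᵘ.* v)))))

/-+ : ∀ a b c d .{{_ : NonZero b}} .{{_ : NonZero d}} →
      + a / b +ℚ + c / d ≡ (+ (a * d + c * b) / (b * d)) {{m*n≢0 b d}}
/-+ a (suc b) c (suc d) = trans (fromℚᵘ-homo-+ (mkℚᵘ (+ a) b) (mkℚᵘ (+ c) d))
  (cong (λ n → fromℚᵘ (mkℚᵘ n (d + b * suc d))) (begin
    + a ℤ.* + suc d ℤ.+ + c ℤ.* + suc b  ≡⟨ cong₂ ℤ._+_ (ℤ.pos-* a (suc d)) (ℤ.pos-* c (suc b)) ⟨
    + (a * suc d) ℤ.+ + (c * suc b)      ≡⟨ ℤ.pos-+ (a * suc d) (c * suc b) ⟨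
    + (a * suc d + c * suc b)            ∎))
  where open ≡-Reasoning

/-* : ∀ a b c d .{{_ : NonZero b}} .{{_ : NonZero d}} →
      (+ a / b) *ℚ (+ c / d) ≡ (+ (a * c) / (b * d)) {{m*n≢0 b d}}
/-* a (suc b) c (suc d) = trans (fromℚᵘ-homo-* (mkℚᵘ (+ a) b) (mkℚᵘ (+ c) d))
  (cong (λ n → fromℚᵘ (mkℚᵘ n (d + b * suc d))) (sym (ℤ.pos-* a c)))

inv-/ : ∀ a b .{{_ : NonZero a}} .{{_ : NonZero b}} → inv (+ a / b) ≡ + b / a
inv-/ a b with + a / b ℚ.≟ 0ℚ
... | yes r≡0 = contradiction (ℚ.toℚᵘ-cong r≡0) (r≄0 a b)
  where
  r≄0 : ∀ a b .{{_ : NonZero a}} .{{_ : NonZero b}} → toℚᵘ (+ a / b) ℚᵘ.≄ toℚᵘ 0ℚ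
  r≄0 (suc a) (suc b) eq with ℚᵘ.≃-trans (ℚᵘ.≃-sym (ℚ.toℚᵘ-fromℚᵘ (mkℚᵘ (+ suc a) b))) eq
  ... | *≡* ()
... | no r≢0 = begin
  1/ r                  ≡⟨ ℚ.*-identityʳ (1/ r) ⟨
  1/ r *ℚ 1ℚ            ≡⟨ cong (1/ r *ℚ_) r*r′≡1 ⟨
  1/ r *ℚ (r *ℚ r′)     ≡⟨ ℚ.*-assoc (1/ r) r r′ ⟨
  (1/ r *ℚ r) *ℚ r′     ≡⟨ cong (_*ℚ r′) (ℚ.*-inverseˡ r) ⟩
  1ℚ *ℚ r′              ≡⟨ ℚ.*-identityˡ r′ ⟩
  r′                    ∎
  where
  open ≡-Reasoning
  r = + a / b
  r′ = + b / a
  instance _ = ≢-nonZero r≢0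
  r*r′≡1 : r *ℚ r′ ≡ 1ℚ
  r*r′≡1 = trans (/-* a b b a) (/-cross (a * b) (b * a) 1 1 {{m*n≢0 b a}} (e a b))
    where
    e : ∀ a b → a * b * 1 ≡ 1 * (b * a)
    e = solve-∀

record Mat : Set where
  constructor mat
  field m11 m12 m21 m22 : ℕ
open Mat

I : Mat
I = mat 1 0 0 1

_⊗_ : Mat → Mat → Mat
X ⊗ Y = mat (m11 X * m11 Y + m12 X * m21 Y) (m11 X * m12 Y + m12 X * m22 Y)
            (m21 X * m11 Y + m22 X * m21 Y) (m21 X * m12 Y + m22 X * m22 Y)

_ᵀ : Mat → Mat
X ᵀ = mat (m11 X) (m21 X) (m12 X) (m22 X)

infixl 7 _⊗_
infixr 6 _◁_
infix 8 _ᵀ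

_◁_ : ℕ → Mat → Mat
a ◁ X = mat (a * m11 X + m21 X) (a * m12 X + m22 X) (m11 X) (m12 X)

-- convergentMat [a₀, …, aₘ] = [[pₘ, pₘ₋₁], [qₘ, qₘ₋₁]] for the convergents pᵢ / qᵢ.
convergentMat : List ℕ → Mat
convergentMat []      = I
convergentMat (a ∷ L) = a ◁ convergentMat L

mat-cong : ∀ {a b c d a′ b′ c′ d′} → a ≡ a′ → b ≡ b′ → c ≡ c′ → d ≡ d′ →
           mat a b c d ≡ mat a′ b′ c′ d′
mat-cong refl refl refl refl = refl

◁-⊗ : ∀ a X Y → a ◁ X ⊗ Y ≡ (a ◁ X) ⊗ Y
◁-⊗ a (mat x11 x12 x21 x22) (mat y11 y12 y21 y22) =
  mat-cong (e a x11 x12 x21 x22 y11 y21) (e a x11 x12 x21 x22 y12 y22) refl refl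
  where
  e : ∀ a x11 x12 x21 x22 y1 y2 → a * (x11 * y1 + x12 * y2) + (x21 * y1 + x22 * y2)
                               ≡ (a * x11 + x21) * y1 + (a * x12 + x22) * y2
  e = solve-∀

⊗-identityˡ : ∀ X → I ⊗ X ≡ X
⊗-identityˡ (mat a b c d) = mat-cong (e a c) (e b d) (e′ a c) (e′ b d)
  where
  e : ∀ a c → 1 * a + 0 * c ≡ a
  e = solve-∀
  e′ : ∀ a c → 0 * a + 1 * c ≡ c
  e′ = solve-∀

convergentMat-++ : ∀ L L′ → convergentMat (L ++ L′) ≡ convergentMat L ⊗ convergentMat L′
convergentMat-++ []      L′ = sym (⊗-identityˡ (convergentMat L′))
convergentMat-++ (a ∷ L) L′ = trans (cong (a ◁_) (convergentMat-++ L L′)) (◁-⊗ a (convergentMat L) (convergentMat L′))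

◁-ᵀ : ∀ a X → (a ◁ X) ᵀ ≡ X ᵀ ⊗ convergentMat [ a ]
◁-ᵀ a (mat x11 x12 x21 x22) = mat-cong (e a x11 x21) (e′ a x11 x21) (e a x12 x22) (e′ a x12 x22)
  where
  e : ∀ a x y → a * x + y ≡ x * (a * 1 + 0) + y * 1
  e = solve-∀
  e′ : ∀ a x y → x ≡ x * (a * 0 + 1) + y * 0
  e′ = solve-∀

convergentMat-reverse : ∀ L → convergentMat (reverse L) ≡ convergentMat L ᵀ
convergentMat-reverse []      = refl
convergentMat-reverse (a ∷ L) = begin
  convergentMat (reverse (a ∷ L))                ≡⟨ cong convergentMat (unfold-reverse a L) ⟩
  convergentMat (reverse L ∷ʳ a)                 ≡⟨ convergentMat-++ (reverse L) [ a ] ⟩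
  convergentMat (reverse L) ⊗ convergentMat [ a ] ≡⟨ cong (_⊗ convergentMat [ a ]) (convergentMat-reverse L) ⟩
  convergentMat L ᵀ ⊗ convergentMat [ a ]         ≡⟨ ◁-ᵀ a (convergentMat L) ⟨
  convergentMat (a ∷ L) ᵀ                         ∎
  where open ≡-Reasoning

det : Mat → ℤ
det X = m11 X * m22 X ⊖ m12 X * m21 X

det-ᵀ : ∀ X → det (X ᵀ) ≡ det X
det-ᵀ X = cong (m11 X * m22 X ⊖_) (*-comm (m21 X) (m12 X))

det-◁ : ∀ a X → det (a ◁ X) ≡ - det X
det-◁ a (mat x11 x12 x21 x22) = begin
  (a * x11 + x21) * x12 ⊖ (a * x12 + x22) * x11      ≡⟨ cong₂ _⊖_ (e a x11 x12 x21) (e′ a x11 x12 x22) ⟩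
  (a * x11 * x12 + x12 * x21) ⊖ (a * x11 * x12 + x11 * x22) ≡⟨ ℤ.+-cancelˡ-⊖ (a * x11 * x12) (x12 * x21) (x11 * x22) ⟩
  x12 * x21 ⊖ x11 * x22                               ≡⟨ ℤ.⊖-swap (x12 * x21) (x11 * x22) ⟩
  - (x11 * x22 ⊖ x12 * x21)                           ∎
  where
  open ≡-Reasoning
  e : ∀ a x y z → (a * x + z) * y ≡ a * x * y + y * z
  e = solve-∀
  e′ : ∀ a x y z → (a * y + z) * x ≡ a * x * y + x * z
  e′ = solve-∀

det-◁◁ : ∀ a b X → det (a ◁ b ◁ X) ≡ det X
det-◁◁ a b X = trans (det-◁ a (b ◁ X)) (trans (cong -_ (det-◁ b X)) (ℤ.neg-involutive (det X)))

det-++ : ∀ L L′ → det (convergentMat (L ++ L′)) ≡ det (convergentMat L) ℤ.* det (convergentMat L′)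
det-++ []      L′ = sym (ℤ.*-identityˡ (det (convergentMat L′)))
det-++ (a ∷ L) L′ = begin
  det (a ◁ convergentMat (L ++ L′))                              ≡⟨ det-◁ a (convergentMat (L ++ L′)) ⟩
  - det (convergentMat (L ++ L′))                                ≡⟨ cong -_ (det-++ L L′) ⟩
  - (det (convergentMat L) ℤ.* det (convergentMat L′))           ≡⟨ ℤ.neg-distribˡ-* (det (convergentMat L)) _ ⟩
  - det (convergentMat L) ℤ.* det (convergentMat L′)             ≡⟨ cong (ℤ._* _) (det-◁ a (convergentMat L)) ⟨
  det (a ◁ convergentMat L) ℤ.* det (convergentMat L′)           ∎
  where open ≡-Reasoning

m⊖n≡1⇒m≡n+1 : ∀ m n → m ⊖ n ≡ + 1 → m ≡ n + 1
m⊖n≡1⇒m≡n+1 m n eq = sym (ℤ.+-injective (begin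
  + (n + 1)            ≡⟨ ℤ.pos-+ n 1 ⟩
  + n ℤ.+ + 1          ≡⟨ cong (λ t → + n ℤ.+ t) eq ⟨
  + n ℤ.+ (m ⊖ n)      ≡⟨ ℤ.distribʳ-⊖-+-pos n m n ⟩
  n + m ⊖ n            ≡⟨ cong (n + m ⊖_) (+-identityʳ n) ⟨
  n + m ⊖ (n + 0)      ≡⟨ ℤ.+-cancelˡ-⊖ n m 0 ⟩
  + m                  ∎))
  where open ≡-Reasoning

det≡1⇒m11*m22≡m12*m21+1 : ∀ X → det X ≡ + 1 → m11 X * m22 X ≡ m12 X * m21 X + 1
det≡1⇒m11*m22≡m12*m21+1 X = m⊖n≡1⇒m≡n+1 (m11 X * m22 X) (m12 X * m21 X)

◁-suc-column : ∀ c X → m11 (1 ◁ c ◁ X) ≡ m11 (suc c ◁ X)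
                      × m21 (1 ◁ c ◁ X) + m21 (suc c ◁ X) ≡ m11 (suc c ◁ X)
◁-suc-column c (mat x _ y _) = e₁ c x y , e₂ c x y
  where
  e₁ : ∀ c x y → 1 * (c * x + y) + x ≡ suc c * x + y
  e₁ = solve-∀
  e₂ : ∀ c x y → c * x + y + x ≡ suc c * x + y
  e₂ = solve-∀

-- convergentMat of the folded list is M ⊗ (w ◁ N) with N = 1 ◁ c ◁ X, and suc c ◁ X = Mᵀ;
-- so the first column of N is (p, p - p′), and det M = 1 turns p q′ into p′ q + 1.
module _ (T : List ℕ) {R : List ℕ} {c : ℕ} (w : ℕ)
         (det≡1 : det (convergentMat T) ≡ + 1) (rev : reverse T ≡ suc c ∷ R) where

  private
    M = convergentMat T
    X = convergentMat R
    N = 1 ◁ c ◁ X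
    p = m11 M
    p′ = m12 M
    q = m21 M
    q′ = m22 M

    ᵀ≡ : suc c ◁ X ≡ M ᵀ
    ᵀ≡ = trans (cong convergentMat (sym rev)) (convergentMat-reverse T)

    N₁₁ : m11 N ≡ p
    N₁₁ = trans (proj₁ (◁-suc-column c X)) (cong m11 ᵀ≡)

    N₂₁ : m21 N + p′ ≡ p
    N₂₁ = subst (λ Y → m21 N + m21 Y ≡ m11 Y) ᵀ≡ (proj₂ (◁-suc-column c X))

    M′≡ : convergentMat (T ++ w ∷ 1 ∷ c ∷ R) ≡ M ⊗ (w ◁ N)
    M′≡ = convergentMat-++ T (w ∷ 1 ∷ c ∷ R)

  fold-m11 : m11 (convergentMat (T ++ w ∷ 1 ∷ c ∷ R)) ≡ suc w * (p * p)
  fold-m11 = begin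
    m11 (convergentMat (T ++ w ∷ 1 ∷ c ∷ R))   ≡⟨ cong m11 M′≡ ⟩
    p * (w * m11 N + m21 N) + p′ * m11 N       ≡⟨ cong (λ t → p * (w * t + m21 N) + p′ * t) N₁₁ ⟩
    p * (w * p + m21 N) + p′ * p               ≡⟨ e₁ w p (m21 N) p′ ⟩
    w * (p * p) + p * (m21 N + p′)             ≡⟨ cong (λ t → w * (p * p) + p * t) N₂₁ ⟩
    w * (p * p) + p * p                        ≡⟨ +-comm (w * (p * p)) (p * p) ⟩
    suc w * (p * p)                            ∎
    where
    open ≡-Reasoning
    e₁ : ∀ w p e p′ → p * (w * p + e) + p′ * p ≡ w * (p * p) + p * (e + p′)
    e₁ = solve-∀

  fold-m21 : m21 (convergentMat (T ++ w ∷ 1 ∷ c ∷ R)) ≡ suc w * (p * q) + 1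
  fold-m21 = begin
    m21 (convergentMat (T ++ w ∷ 1 ∷ c ∷ R))   ≡⟨ cong m21 M′≡ ⟩
    q * (w * m11 N + m21 N) + q′ * m11 N       ≡⟨ cong (λ t → q * (w * t + m21 N) + q′ * t) N₁₁ ⟩
    q * (w * p + m21 N) + q′ * p               ≡⟨ e₁ w p q (m21 N) q′ ⟩
    w * (p * q) + q * m21 N + p * q′           ≡⟨ cong (λ t → w * (p * q) + q * m21 N + t) det′ ⟩
    w * (p * q) + q * m21 N + (p′ * q + 1)     ≡⟨ e₂ w p q (m21 N) p′ ⟩
    w * (p * q) + q * (m21 N + p′) + 1         ≡⟨ cong (λ t → w * (p * q) + q * t + 1) N₂₁ ⟩
    w * (p * q) + q * p + 1                    ≡⟨ e₃ w p q ⟩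
    suc w * (p * q) + 1                        ∎
    where
    open ≡-Reasoning
    e₁ : ∀ w p q e q′ → q * (w * p + e) + q′ * p ≡ w * (p * q) + q * e + p * q′
    e₁ = solve-∀
    e₂ : ∀ w p q e p′ → w * (p * q) + q * e + (p′ * q + 1) ≡ w * (p * q) + q * (e + p′) + 1
    e₂ = solve-∀
    e₃ : ∀ w p q → w * (p * q) + q * p + 1 ≡ suc w * (p * q) + 1
    e₃ = solve-∀
    det′ : p * q′ ≡ p′ * q + 1
    det′ = det≡1⇒m11*m22≡m12*m21+1 M det≡1

  fold-det : det (convergentMat (T ++ w ∷ 1 ∷ c ∷ R)) ≡ + 1
  fold-det = begin
    det (convergentMat (T ++ w ∷ 1 ∷ c ∷ R))      ≡⟨ det-++ T (w ∷ 1 ∷ c ∷ R) ⟩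
    det M ℤ.* det (w ◁ 1 ◁ c ◁ X)                 ≡⟨ cong (det M ℤ.*_) tail≡ ⟩
    det M ℤ.* det M                               ≡⟨ cong₂ ℤ._*_ det≡1 det≡1 ⟩
    + 1                                           ∎
    where
    open ≡-Reasoning
    tail≡ : det (w ◁ 1 ◁ c ◁ X) ≡ det M
    tail≡ = begin
      det (w ◁ 1 ◁ c ◁ X)       ≡⟨ det-◁◁ w 1 (c ◁ X) ⟩
      det (c ◁ X)               ≡⟨ det-◁ c X ⟩
      - det X                   ≡⟨ det-◁ (suc c) X ⟨
      det (suc c ◁ X)           ≡⟨ cong det ᵀ≡ ⟩
      det (M ᵀ)                 ≡⟨ det-ᵀ M ⟩
      det M                     ∎

+-nonZeroʳ : ∀ m n .{{_ : NonZero n}} → NonZero (m + n)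
+-nonZeroʳ m n = >-nonZero (<-≤-trans (>-nonZero⁻¹ n) (m≤n+m n m))

-- With a nonzero last entry no inversion inside cf meets the junk value inv 0 = 0.
LastPositive : List ℕ → Set
LastPositive []          = ⊥
LastPositive (a ∷ [])    = NonZero a
LastPositive (_ ∷ b ∷ L) = LastPositive (b ∷ L)

LastPositive-∷ : ∀ a L → LastPositive L → LastPositive (a ∷ L)
LastPositive-∷ a (b ∷ L) lp = lp

convergent-nonZero : ∀ L → LastPositive L → NonZero (m11 (convergentMat L)) × NonZero (m21 (convergentMat L))
convergent-nonZero (suc a ∷ [])  _  = _ , _
convergent-nonZero (a ∷ b ∷ L)   lp with convergent-nonZero (b ∷ L) lp
... | p≢0 , q≢0 = +-nonZeroʳ (a * m11 (convergentMat (b ∷ L))) _ {{q≢0}} , p≢0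

cf-convergent : ∀ L (lp : LastPositive L) →
                cf L ≡ (+ m11 (convergentMat L) / m21 (convergentMat L)) {{proj₂ (convergent-nonZero L lp)}}
cf-convergent (suc a ∷ [])  _  = ℚ./-cong (cong +_ (sym (trans (+-identityʳ _) (*-identityʳ (suc a))))) refl
cf-convergent (a ∷ b ∷ L)   lp = begin
  ℕ→ℚ a +ℚ inv (cf (b ∷ L))          ≡⟨ cong (λ t → ℕ→ℚ a +ℚ inv t) (cf-convergent (b ∷ L) lp) ⟩
  + a / 1 +ℚ inv (+ p / q)           ≡⟨ cong (+ a / 1 +ℚ_) (inv-/ p q) ⟩
  + a / 1 +ℚ + q / p                 ≡⟨ /-+ a 1 q p ⟩
  + (a * p + q * 1) / (1 * p)        ≡⟨ /-cross (a * p + q * 1) (1 * p) (a * p + q) p (e a p q) ⟩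
  + (a * p + q) / p                  ∎
  where
  open ≡-Reasoning
  p = m11 (convergentMat (b ∷ L))
  q = m21 (convergentMat (b ∷ L))
  instance
    p≢0 = proj₁ (convergent-nonZero (b ∷ L) lp)
    q≢0 = proj₂ (convergent-nonZero (b ∷ L) lp)
    1*p≢0 = m*n≢0 1 p
  e : ∀ a p q → (a * p + q * 1) * p ≡ (a * p + q) * (1 * p)
  e = solve-∀

cf-extend : ∀ a s T T′ → LastPositive T → LastPositive T′ →
            m11 (convergentMat T′) ≡ s * (m11 (convergentMat T) * m11 (convergentMat T)) →
            m21 (convergentMat T′) ≡ s * (m11 (convergentMat T) * m21 (convergentMat T)) + 1 →
            cf (a ∷ T′) ≡ cf (a ∷ T) +ℚ inv (ℕ→ℚ (m11 (convergentMat T′)))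
cf-extend a s T T′ lp lp′ e11 e21 = begin
  cf (a ∷ T′)                                 ≡⟨ cf-convergent (a ∷ T′) (LastPositive-∷ a T′ lp′) ⟩
  + (a * p′ + q′) / p′
    ≡⟨ /-cross (a * p′ + q′) p′ ((a * p + q) * p′ + 1 * p) (p * p′) (cross a s p q e11 e21) ⟩
  + ((a * p + q) * p′ + 1 * p) / (p * p′)
    ≡⟨ /-+ (a * p + q) p 1 p′ ⟨
  + (a * p + q) / p +ℚ + 1 / p′
    ≡⟨ cong₂ _+ℚ_ (cf-convergent (a ∷ T) (LastPositive-∷ a T lp)) (inv-/ p′ 1) ⟨
  cf (a ∷ T) +ℚ inv (ℕ→ℚ p′)                  ∎
  where
  open ≡-Reasoning
  p = m11 (convergentMat T)
  q = m21 (convergentMat T)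
  p′ = m11 (convergentMat T′)
  q′ = m21 (convergentMat T′)
  instance
    p≢0 = proj₁ (convergent-nonZero T lp)
    p′≢0 = proj₁ (convergent-nonZero T′ lp′)
    pp′≢0 = m*n≢0 p p′
  cross : ∀ a s p q {p′ q′} → p′ ≡ s * (p * p) → q′ ≡ s * (p * q) + 1 →
          (a * p′ + q′) * (p * p′) ≡ ((a * p + q) * p′ + 1 * p) * p′
  cross a s p q refl refl = e a s p q
    where
    e : ∀ a s p q → (a * (s * (p * p)) + (s * (p * q) + 1)) * (p * (s * (p * p)))
                  ≡ ((a * p + q) * (s * (p * p)) + 1 * p) * (s * (p * p))
    e = solve-∀

product-applyUpTo-* : ∀ (f g : ℕ → ℕ) n →
  product (applyUpTo (λ k → f k * g k) n) ≡ product (applyUpTo f n) * product (applyUpTo g n)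
product-applyUpTo-* f g zero    = refl
product-applyUpTo-* f g (suc n) = trans (cong (f 0 * g 0 *_) (product-applyUpTo-* (f ∘ suc) (g ∘ suc) n))
                                        (e (f 0) (g 0) _ _)
  where
  e : ∀ a b c d → a * b * (c * d) ≡ a * c * (b * d)
  e = solve-∀

x-suc : ∀ z n → x z (2 + n) ≡ x z (1 + n) * x z (1 + n) * z (2 + n)
x-suc z n = begin
  product (map (G (2 + n)) (upTo (1 + n)))                          ≡⟨ cong product (map-upTo (G (2 + n)) (1 + n)) ⟩
  product (applyUpTo (G (2 + n)) (1 + n))                           ≡⟨ cong product (applyUpTo-∷ʳ (G (2 + n)) n) ⟨
  product (applyUpTo (G (2 + n)) n ++ [ G (2 + n) n ])              ≡⟨ product-++ (applyUpTo (G (2 + n)) n) [ G (2 + n) n ] ⟩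
  product (applyUpTo (G (2 + n)) n) * (G (2 + n) n * 1)             ≡⟨ cong₂ _*_ (cong product (applyUpTo-cong n squares)) last ⟩
  product (applyUpTo (λ k → G (1 + n) k * G (1 + n) k) n) * z (2 + n)
    ≡⟨ cong (_* z (2 + n)) (product-applyUpTo-* (G (1 + n)) (G (1 + n)) n) ⟩
  P * P * z (2 + n)
    ≡⟨ cong (λ L → product L * product L * z (2 + n)) (map-upTo (G (1 + n)) n) ⟨
  x z (1 + n) * x z (1 + n) * z (2 + n)                             ∎
  where
  open ≡-Reasoning
  G : ℕ → ℕ → ℕ
  G j k = z (k + 2) ^ (2 ^ (j ∸ (k + 2)))
  P = product (applyUpTo (G (1 + n)) n)
  last : G (2 + n) n * 1 ≡ z (2 + n)
  last rewrite +-comm n 2 | n∸n≡0 n = trans (*-identityʳ _) (*-identityʳ _)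
  squares : ∀ k → k < n → G (2 + n) k ≡ G (1 + n) k * G (1 + n) k
  squares k k<n = begin
    z (k + 2) ^ (2 ^ (2 + n ∸ (k + 2)))   ≡⟨ cong (λ t → z (k + 2) ^ (2 ^ t)) (+-∸-assoc 1 k+2≤1+n) ⟩
    z (k + 2) ^ (e + (e + 0))             ≡⟨ cong (λ t → z (k + 2) ^ (e + t)) (+-identityʳ e) ⟩
    z (k + 2) ^ (e + e)                   ≡⟨ ^-distribˡ-+-* (z (k + 2)) e e ⟩
    G (1 + n) k * G (1 + n) k             ∎
    where
    e = 2 ^ (1 + n ∸ (k + 2))
    k+2≤1+n : k + 2 ≤ 1 + n
    k+2≤1+n = subst (_≤ suc n) (+-comm 2 k) (s≤s k<n)

sumℚ-∷ʳ : ∀ xs y → foldr _+ℚ_ 0ℚ (xs ++ [ y ]) ≡ foldr _+ℚ_ 0ℚ xs +ℚ y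
sumℚ-∷ʳ []       y = trans (ℚ.+-identityʳ y) (sym (ℚ.+-identityˡ y))
sumℚ-∷ʳ (a ∷ xs) y = trans (cong (a +ℚ_) (sumℚ-∷ʳ xs y)) (sym (ℚ.+-assoc a _ y))

S-suc : ∀ z n → S z (suc n) ≡ S z n +ℚ inv (ℕ→ℚ (x z (suc n)))
S-suc z n = begin
  foldr _+ℚ_ 0ℚ (map h (upTo (suc n)))        ≡⟨ cong (foldr _+ℚ_ 0ℚ) (map-upTo h (suc n)) ⟩
  foldr _+ℚ_ 0ℚ (applyUpTo h (suc n))         ≡⟨ cong (foldr _+ℚ_ 0ℚ) (applyUpTo-∷ʳ h n) ⟨
  foldr _+ℚ_ 0ℚ (applyUpTo h n ++ [ h n ])    ≡⟨ sumℚ-∷ʳ (applyUpTo h n) (h n) ⟩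
  foldr _+ℚ_ 0ℚ (applyUpTo h n) +ℚ h n        ≡⟨ cong (λ L → foldr _+ℚ_ 0ℚ L +ℚ h n) (map-upTo h n) ⟨
  S z n +ℚ h n                                ∎
  where
  open ≡-Reasoning
  h : ℕ → ℚ
  h k = inv (ℕ→ℚ (x z (suc k)))

-- The recursion of the statement: f = a⁽ⁿ⁾, g = a⁽ⁿ⁺¹⁾, ℓ = ℓₙ and w = z_{n+1} - 1.
record IsFolding (f : ℕ → ℕ) (ℓ w : ℕ) (g : ℕ → ℕ) : Set where
  field
    prefix  : ∀ j → j < ℓ → g j ≡ f j
    at-ℓ    : g ℓ ≡ w
    at-1+ℓ  : g (suc ℓ) ≡ 1
    at-ℓ+2  : g (ℓ + 2) ≡ f (ℓ ∸ 1) ∸ 1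
    mirror  : ∀ j → ℓ + 3 ≤ j → j ≤ 2 * ℓ → g j ≡ f (2 * ℓ ∸ j + 1)

isFolding-tail : ∀ {f g ℓ w} → IsFolding f ℓ w g → 2 ≤ ℓ →
  ∃ λ R → reverse (applyUpTo (f ∘ suc) (ℓ ∸ 1)) ≡ f (ℓ ∸ 1) ∷ R
        × applyUpTo (g ∘ suc) (2 * ℓ) ≡ applyUpTo (f ∘ suc) (ℓ ∸ 1) ++ w ∷ 1 ∷ (f (ℓ ∸ 1) ∸ 1) ∷ R
isFolding-tail {f} {g} {suc (suc k)} {w} fold (s≤s (s≤s _)) = R , reverse-applyUpTo (f ∘ suc) (suc k) , (begin
  applyUpTo (g ∘ suc) (2 * ℓ)                                   ≡⟨ cong (applyUpTo (g ∘ suc)) (2ℓ≡ k) ⟩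
  applyUpTo (g ∘ suc) (suc k + (3 + k))                         ≡⟨ applyUpTo-++ (g ∘ suc) (suc k) (3 + k) ⟩
  applyUpTo (g ∘ suc) (suc k) ++ applyUpTo (λ i → g (ℓ + i)) (3 + k)
    ≡⟨ cong₂ _++_ (applyUpTo-cong (suc k) (λ i i<1+k → prefix (suc i) (s<s i<1+k))) middle ⟩
  applyUpTo (f ∘ suc) (suc k) ++ w ∷ 1 ∷ (f (suc k) ∸ 1) ∷ R    ∎)
  where
  open ≡-Reasoning
  open IsFolding fold
  ℓ = suc (suc k)
  R = applyUpTo (λ i → f (suc (k ∸ suc i))) k
  2ℓ≡ : ∀ k → 2 * suc (suc k) ≡ suc k + (3 + k)
  2ℓ≡ = solve-∀
  index : ∀ i → 2 * ℓ ∸ (ℓ + (3 + i)) + 1 ≡ suc (k ∸ suc i)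
  index i = begin
    2 * ℓ ∸ (ℓ + (3 + i)) + 1     ≡⟨ cong (_+ 1) ([m+n]∸[m+o]≡n∸o ℓ (ℓ + 0) (3 + i)) ⟩
    (k + 0) ∸ suc i + 1           ≡⟨ cong (λ t → t ∸ suc i + 1) (+-identityʳ k) ⟩
    k ∸ suc i + 1                 ≡⟨ +-comm (k ∸ suc i) 1 ⟩
    suc (k ∸ suc i)               ∎
  mirrored : ∀ i → i < k → g (ℓ + (3 + i)) ≡ f (suc (k ∸ suc i))
  mirrored i i<k = trans (mirror (ℓ + (3 + i)) (+-monoʳ-≤ ℓ (m≤m+n 3 i))
                                 (+-monoʳ-≤ ℓ (≤-trans (s≤s (s≤s i<k)) (m≤m+n ℓ 0))))
                         (cong f (index i))
  middle : applyUpTo (λ i → g (ℓ + i)) (3 + k) ≡ w ∷ 1 ∷ (f (suc k) ∸ 1) ∷ R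
  middle = cong₂ _∷_ (trans (cong g (+-identityʳ ℓ)) at-ℓ)
          (cong₂ _∷_ (trans (cong g (+-comm ℓ 1)) at-1+ℓ)
          (cong₂ _∷_ at-ℓ+2 (applyUpTo-cong k mirrored)))

≡true : ∀ {b} → Bool.T b → b ≡ true
≡true {true} _ = refl

≡false : ∀ {b} → ¬ Bool.T b → b ≡ false
≡false {false} _  = refl
≡false {true}  ¬t = contradiction _ ¬t

<ᵇ-true : ∀ {m n} → m < n → (m <ᵇ n) ≡ true
<ᵇ-true = ≡true ∘ <⇒<ᵇ

<ᵇ-false : ∀ {m n} → n ≤ m → (m <ᵇ n) ≡ false
<ᵇ-false {m} {n} n≤m = ≡false (≤⇒≯ n≤m ∘ <ᵇ⇒< m n)

≡ᵇ-refl : ∀ n → (n ≡ᵇ n) ≡ true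
≡ᵇ-refl n = ≡true (≡⇒≡ᵇ n n refl)

≡ᵇ-false : ∀ {m n} → n < m → (m ≡ᵇ n) ≡ false
≡ᵇ-false {m} {n} n<m = ≡false (>⇒≢ n<m ∘ ≡ᵇ⇒≡ m n)

≤ᵇ-true : ∀ {m n} → m ≤ n → (m ≤ᵇ n) ≡ true
≤ᵇ-true = ≡true ∘ ≤⇒≤ᵇ

coef-isFolding : ∀ z m → IsFolding (coef z (3 + m)) (len (3 + m)) (z (4 + m) ∸ 1) (coef z (4 + m))
coef-isFolding z m = record
  { prefix = prefix ; at-ℓ = at-ℓ ; at-1+ℓ = at-1+ℓ ; at-ℓ+2 = at-ℓ+2 ; mirror = mirror }
  where
  ℓ = len (3 + m)
  f = coef z (3 + m)
  g = coef z (4 + m)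

  prefix : ∀ j → j < ℓ → g j ≡ f j
  prefix j j<ℓ rewrite <ᵇ-true j<ℓ = refl

  at-ℓ : g ℓ ≡ z (4 + m) ∸ 1
  at-ℓ rewrite <ᵇ-false (≤-refl {ℓ}) | ≡ᵇ-refl ℓ = refl

  at-1+ℓ : g (suc ℓ) ≡ 1
  at-1+ℓ rewrite <ᵇ-false (n≤1+n ℓ) | ≡ᵇ-false (n<1+n ℓ) | ≡ᵇ-refl ℓ = refl

  at-ℓ+2 : g (ℓ + 2) ≡ f (ℓ ∸ 1) ∸ 1
  at-ℓ+2 rewrite <ᵇ-false (m≤m+n ℓ 2)
               | ≡ᵇ-false {ℓ + 2} (m<m+n ℓ {2} z<s)
               | ≡ᵇ-false {ℓ + 2} (subst (suc ℓ <_) (+-comm 2 ℓ) (n<1+n (suc ℓ)))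
               | ≡ᵇ-refl (ℓ + 2) = refl

  ℓ+i<j : ∀ {j} i → ℓ + 3 ≤ j → i < 3 → ℓ + i < j
  ℓ+i<j i ℓ+3≤j i<3 = <-≤-trans (+-monoʳ-< ℓ i<3) ℓ+3≤j

  mirror : ∀ j → ℓ + 3 ≤ j → j ≤ 2 * ℓ → g j ≡ f (2 * ℓ ∸ j + 1)
  mirror j ℓ+3≤j j≤2ℓ rewrite <ᵇ-false (≤-trans (m≤m+n ℓ 3) ℓ+3≤j)
                          | ≡ᵇ-false (subst (_< j) (+-identityʳ ℓ) (ℓ+i<j 0 ℓ+3≤j z<s))
                          | ≡ᵇ-false (subst (_< j) (+-comm ℓ 1) (ℓ+i<j 1 ℓ+3≤j (s<s z<s)))
                          | ≡ᵇ-false (ℓ+i<j 2 ℓ+3≤j (s<s (s<s z<s)))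
                          | ≤ᵇ-true j≤2ℓ = refl

suc-∸1 : ∀ {n} → 1 ≤ n → suc (n ∸ 1) ≡ n
suc-∸1 (s≤s _) = refl

len-suc : ∀ m → len (4 + m) ≡ suc (2 * len (3 + m))
len-suc m = begin
  3 * (2 * y) ∸ 1        ≡⟨ cong (_∸ 1) (e y) ⟩
  2 * (3 * y) ∸ 1        ≡⟨ 2*∸1 (≤-trans (m^n>0 2 (suc m)) (m≤n*m y 3)) ⟩
  suc (2 * (3 * y ∸ 1))  ∎
  where
  open ≡-Reasoning
  y = 2 ^ suc m
  e : ∀ y → 3 * (2 * y) ≡ 2 * (3 * y)
  e = solve-∀
  2*∸1 : ∀ {x} → 1 ≤ x → 2 * x ∸ 1 ≡ suc (2 * (x ∸ 1))
  2*∸1 {suc x} _ = +-suc x (x + 0)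

3≤len : ∀ m → 3 ≤ len (3 + m)
3≤len zero    = s≤s (s≤s (s≤s z≤n))
3≤len (suc m) = subst (3 ≤_) (sym (len-suc m)) (s≤s (≤-trans (≤-trans (n≤1+n 2) (3≤len m)) (m≤n*m (len (3 + m)) 2)))

tailCoefs : (ℕ → ℕ) → ℕ → List ℕ
tailCoefs z n = applyUpTo (coef z n ∘ suc) (len n ∸ 1)

coef-0 : ∀ z m → coef z (3 + m) 0 ≡ 1
coef-0 z zero    = refl
coef-0 z (suc m) = trans (IsFolding.prefix (coef-isFolding z m) 0 (≤-trans (s≤s z≤n) (3≤len m))) (coef-0 z m)

coef-1 : ∀ z m → coef z (3 + m) 1 ≡ z 2 ∸ 1
coef-1 z zero    = refl
coef-1 z (suc m) = trans (IsFolding.prefix (coef-isFolding z m) 1 (≤-trans (s≤s (s≤s z≤n)) (3≤len m))) (coef-1 z m)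

coef-last : ∀ z m → 2 ≤ z 2 → NonZero (coef z (3 + m) (len (3 + m) ∸ 1))
coef-last z zero    2≤z₂ = >-nonZero (≤-trans (s≤s z≤n) 2≤z₂)
coef-last z (suc m) 2≤z₂ = subst NonZero (sym last≡) (∸1-nonZero 2≤z₂)
  where
  ℓ = len (3 + m)
  ∸1-nonZero : ∀ {n} → 2 ≤ n → NonZero (n ∸ 1)
  ∸1-nonZero (s≤s (s≤s _)) = _
  last≡ : coef z (4 + m) (len (4 + m) ∸ 1) ≡ z 2 ∸ 1
  last≡ = begin
    coef z (4 + m) (len (4 + m) ∸ 1)      ≡⟨ cong (λ j → coef z (4 + m) (j ∸ 1)) (len-suc m) ⟩
    coef z (4 + m) (2 * ℓ)
      ≡⟨ IsFolding.mirror (coef-isFolding z m) (2 * ℓ) (+-monoʳ-≤ ℓ (≤-trans (3≤len m) (m≤m+n ℓ 0))) ≤-refl ⟩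
    coef z (3 + m) (2 * ℓ ∸ 2 * ℓ + 1)    ≡⟨ cong (λ j → coef z (3 + m) (j + 1)) (n∸n≡0 (2 * ℓ)) ⟩
    coef z (3 + m) 1                      ≡⟨ coef-1 z m ⟩
    z 2 ∸ 1                               ∎
    where open ≡-Reasoning

LastPositive-applyUpTo : ∀ (f : ℕ → ℕ) k → NonZero (f k) → LastPositive (applyUpTo f (suc k))
LastPositive-applyUpTo f zero    nz = nz
LastPositive-applyUpTo f (suc k) nz = LastPositive-applyUpTo (f ∘ suc) k nz

tailCoefs-lastPositive : ∀ z m → 2 ≤ z 2 → LastPositive (tailCoefs z (3 + m))
tailCoefs-lastPositive z m 2≤z₂ =
  applyUpTo-suc-lastPositive (coef z (3 + m)) (≤-trans (n≤1+n 2) (3≤len m)) (coef-last z m 2≤z₂)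
  where
  applyUpTo-suc-lastPositive : ∀ (f : ℕ → ℕ) {ℓ} → 2 ≤ ℓ → NonZero (f (ℓ ∸ 1)) →
                               LastPositive (applyUpTo (f ∘ suc) (ℓ ∸ 1))
  applyUpTo-suc-lastPositive f {suc (suc k)} (s≤s (s≤s _)) nz = LastPositive-applyUpTo (f ∘ suc) k nz

coefs-tailCoefs : ∀ z m → coefs z (3 + m) ≡ 1 ∷ tailCoefs z (3 + m)
coefs-tailCoefs z m = begin
  map (coef z (3 + m)) (upTo ℓ)                           ≡⟨ map-upTo (coef z (3 + m)) ℓ ⟩
  applyUpTo (coef z (3 + m)) ℓ                            ≡⟨ applyUpTo-pred (≤-trans (s≤s z≤n) (3≤len m)) ⟩
  coef z (3 + m) 0 ∷ tailCoefs z (3 + m)                  ≡⟨ cong (_∷ tailCoefs z (3 + m)) (coef-0 z m) ⟩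
  1 ∷ tailCoefs z (3 + m)                                 ∎
  where
  open ≡-Reasoning
  ℓ = len (3 + m)
  applyUpTo-pred : ∀ {f : ℕ → ℕ} {n} → 1 ≤ n → applyUpTo f n ≡ f 0 ∷ applyUpTo (f ∘ suc) (n ∸ 1)
  applyUpTo-pred (s≤s _) = refl

tailCoefs-fold : ∀ z m → 2 ≤ z 2 → ∃₂ λ c R →
  reverse (tailCoefs z (3 + m)) ≡ suc c ∷ R ×
  tailCoefs z (4 + m) ≡ tailCoefs z (3 + m) ++ (z (4 + m) ∸ 1) ∷ 1 ∷ c ∷ R
tailCoefs-fold z m 2≤z₂ with isFolding-tail (coef-isFolding z m) (≤-trans (n≤1+n 2) (3≤len m))
... | R , rev , tail≡ = a ∸ 1 , R ,
  trans rev (cong (_∷ R) (sym (suc-∸1 (>-nonZero⁻¹ a {{coef-last z m 2≤z₂}})))) ,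
  trans (cong (λ j → applyUpTo (coef z (4 + m) ∘ suc) (j ∸ 1)) (len-suc m)) tail≡
  where a = coef z (3 + m) (len (3 + m) ∸ 1)

Invariant : (ℕ → ℕ) → ℕ → List ℕ → Set
Invariant z n T = x z n ≡ m11 (convergentMat T) × det (convergentMat T) ≡ + 1 × S z n ≡ cf (1 ∷ T)

base-convergents : ∀ {u v} → 2 ≤ u → 1 ≤ v → let T = (u ∸ 1) ∷ 1 ∷ (v ∸ 1) ∷ u ∷ [] in
  m11 (convergentMat T) ≡ v * (m11 (convergentMat [ u ]) * m11 (convergentMat [ u ])) ×
  m21 (convergentMat T) ≡ v * (m11 (convergentMat [ u ]) * m21 (convergentMat [ u ])) + 1
base-convergents {suc (suc a)} {suc b} (s≤s (s≤s _)) (s≤s _) = e₁ a b , e₂ a b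
  where
  -- The ring solver only reads polynomials, so the matrix entries are written out unfolded.
  e₁ : ∀ a b → suc a * (1 * (b * (suc (suc a) * 1 + 0) + 1) + (suc (suc a) * 1 + 0)) + (b * (suc (suc a) * 1 + 0) + 1)
             ≡ suc b * ((suc (suc a) * 1 + 0) * (suc (suc a) * 1 + 0))
  e₁ = solve-∀
  e₂ : ∀ a b → 1 * (b * (suc (suc a) * 1 + 0) + 1) + (suc (suc a) * 1 + 0)
             ≡ suc b * ((suc (suc a) * 1 + 0) * 1) + 1
  e₂ = solve-∀

invariant-3 : ∀ z → 2 ≤ z 2 → 1 ≤ z 3 → Invariant z 3 (tailCoefs z 3)
invariant-3 z 2≤z₂ 1≤z₃ = x≡ , det≡ , S≡
  where
  open ≡-Reasoning
  T = tailCoefs z 3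
  u≢0 : NonZero (z 2)
  u≢0 = >-nonZero (≤-trans (s≤s z≤n) 2≤z₂)
  m11≡ = proj₁ (base-convergents 2≤z₂ 1≤z₃)
  x≡ : x z 3 ≡ m11 (convergentMat T)
  x≡ = trans (e (z 2) (z 3)) (sym m11≡)
    where
    e : ∀ u v → u * (u * 1) * (v * 1 * 1) ≡ v * ((u * 1 + 0) * (u * 1 + 0))
    e = solve-∀
  det≡ : det (convergentMat T) ≡ + 1
  det≡ = trans (det-◁◁ (z 2 ∸ 1) 1 _) (det-◁◁ (z 3 ∸ 1) (z 2) I)
  S₂≡ : S z 2 ≡ cf (1 ∷ [ z 2 ])
  S₂≡ = cong₂ _+ℚ_ (inv-/ 1 1) (trans (ℚ.+-identityʳ _) (cong (inv ∘ ℕ→ℚ) x₂≡))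
    where
    x₂≡ : x z 2 ≡ z 2
    x₂≡ = trans (*-identityʳ _) (*-identityʳ _)
  S≡ : S z 3 ≡ cf (1 ∷ T)
  S≡ = begin
    S z 3                                           ≡⟨ S-suc z 2 ⟩
    S z 2 +ℚ inv (ℕ→ℚ (x z 3))                      ≡⟨ cong₂ (λ s t → s +ℚ inv (ℕ→ℚ t)) S₂≡ x≡ ⟩
    cf (1 ∷ [ z 2 ]) +ℚ inv (ℕ→ℚ (m11 (convergentMat T)))
      ≡⟨ cf-extend 1 (z 3) [ z 2 ] T u≢0 u≢0 m11≡ (proj₂ (base-convergents 2≤z₂ 1≤z₃)) ⟨
    cf (1 ∷ T)                                      ∎

invariant-suc : ∀ z m → 2 ≤ z 2 → 1 ≤ z (4 + m) →
                Invariant z (3 + m) (tailCoefs z (3 + m)) → Invariant z (4 + m) (tailCoefs z (4 + m))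
invariant-suc z m 2≤z₂ 1≤z′ (x≡ , det≡ , S≡) with tailCoefs-fold z m 2≤z₂
... | c , R , rev , T′≡ = subst (Invariant z (4 + m)) (sym T′≡) (x′≡ , fold-det T w det≡ rev , S′≡)
  where
  open ≡-Reasoning
  T = tailCoefs z (3 + m)
  w = z (4 + m) ∸ 1
  T′ = T ++ w ∷ 1 ∷ c ∷ R
  p = m11 (convergentMat T)
  x′≡ : x z (4 + m) ≡ m11 (convergentMat T′)
  x′≡ = begin
    x z (4 + m)                        ≡⟨ x-suc z (2 + m) ⟩
    x z (3 + m) * x z (3 + m) * z (4 + m) ≡⟨ cong₂ (λ s t → s * s * t) x≡ (sym (suc-∸1 1≤z′)) ⟩
    p * p * suc w                      ≡⟨ *-comm (p * p) (suc w) ⟩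
    suc w * (p * p)                    ≡⟨ fold-m11 T w det≡ rev ⟨
    m11 (convergentMat T′)             ∎
  lp′ : LastPositive T′
  lp′ = subst LastPositive T′≡ (tailCoefs-lastPositive z (suc m) 2≤z₂)
  S′≡ : S z (4 + m) ≡ cf (1 ∷ T′)
  S′≡ = begin
    S z (4 + m)                                   ≡⟨ S-suc z (3 + m) ⟩
    S z (3 + m) +ℚ inv (ℕ→ℚ (x z (4 + m)))        ≡⟨ cong₂ (λ s t → s +ℚ inv (ℕ→ℚ t)) S≡ x′≡ ⟩
    cf (1 ∷ T) +ℚ inv (ℕ→ℚ (m11 (convergentMat T′)))
      ≡⟨ cf-extend 1 (suc w) T T′ (tailCoefs-lastPositive z m 2≤z₂) lp′ (fold-m11 T w det≡ rev) (fold-m21 T w det≡ rev) ⟨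
    cf (1 ∷ T′)                                   ∎

invariant : ∀ z → 2 ≤ z 2 → (∀ j → 2 ≤ j → 1 ≤ z j) → ∀ m → Invariant z (3 + m) (tailCoefs z (3 + m))
invariant z 2≤z₂ 1≤z zero    = invariant-3 z 2≤z₂ (1≤z 3 (s≤s (s≤s z≤n)))
invariant z 2≤z₂ 1≤z (suc m) = invariant-suc z m 2≤z₂ (1≤z (4 + m) (s≤s (s≤s z≤n))) (invariant z 2≤z₂ 1≤z m)

proposition1 : (z : ℕ → ℕ) → 2 ≤ z 2 → (∀ j → 2 ≤ j → 1 ≤ z j) →
               (n : ℕ) → 3 ≤ n → S z n ≡ cf (coefs z n)
proposition1 z 2≤z₂ 1≤z 0             ()
proposition1 z 2≤z₂ 1≤z 1             (s≤s ())
proposition1 z 2≤z₂ 1≤z 2             (s≤s (s≤s ()))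
proposition1 z 2≤z₂ 1≤z (suc (suc (suc m))) _ =
  trans (proj₂ (proj₂ (invariant z 2≤z₂ 1≤z m))) (cong cf (sym (coefs-tailCoefs z m)))
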